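{- Let $k\ge5$ be odd. There exist $\delta=\delta(k)>0$ with $\delta=\Omega(k^{ -4})$ and a degree-$3$ multilinear polynomial $\mathcal{Q}:\{ -1,1\}^k\to\mathbb{R}$ that $\delta$-separates $\mathrm{Thr}_k^{ -1}$. Consequently, $\mathrm{Thr}_k^{ -1}$ does not support a $3$-wise uniform distribution.
   Context: For odd $k$ and $\theta\in\{ -k,-k+2,\dots,k\}$, $\mathrm{Thr}_k^\theta:\{ -1,1\}^k\to\{0,1\}$ is $1$ on $z$ iff $\sum_{i=1}^k z_i\ge\theta$. For $P:\{ -1,1\}^k\to\{0,1\}$ and $0<\delta<1$, a multilinear polynomial $Q(z)=\sum_S\widehat Q(S)\prod_{i\in S}z_i$ $\delta$-separates $P$ if $Q(z)\ge\delta-1$ for all $z$, $Q(z)\ge\delta$ for all $z\in P^{ -1}(1)$, and $\widehat Q(\emptyset)=0$. A distribution on $\{ -1,1\}^k$ is $t$-wise uniform if every marginal on $t$ coordinates is uniform; $P$ supports it if its support lies in $P^{ -1}(1)$.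
   Formalization: The coefficients of $\mathcal{Q}$, δ and the constant hidden in $\Omega(k^{ -4})$ are rational rather than real, and the 3-wise uniform distributions are taken with rational weights. -}

module Defs where

open import Data.Bool using (Bool; true; false; if_then_else_)
open import Data.Nat as ℕ using (ℕ; zero; suc)
open import Data.Integer as ℤ using (ℤ; +_; -[1+_])
open import Data.Rational as ℚ using (ℚ; 0ℚ; 1ℚ; _+_; _*_; _-_; _≤_; _<_)
open import Data.Vec using (Vec; []; _∷_)
open import Data.List using (List; []; _∷_; map; _++_)
open import Relation.Binary.PropositionalEquality using (_≡_)
open import Relation.Nullary using (¬_)
open import Data.Product using (_×_)

-- A point of {-1,1}^k is a Vec Bool k: true ↦ +1, false ↦ -1.
-- A subset S ⊆ [k] is also a Vec Bool k (indicator vector).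

sgnℤ : Bool → ℤ
sgnℤ true  = + 1
sgnℤ false = -[1+ 0 ]

sgnℚ : Bool → ℚ
sgnℚ true  = 1ℚ
sgnℚ false = ℚ.- 1ℚ

cube : (k : ℕ) → List (Vec Bool k)
cube zero    = [] ∷ []
cube (suc k) = map (true ∷_) (cube k) ++ map (false ∷_) (cube k)

sumℚ : List ℚ → ℚ
sumℚ []       = 0ℚ
sumℚ (x ∷ xs) = x + sumℚ xs

Σcube : (k : ℕ) → (Vec Bool k → ℚ) → ℚ
Σcube k f = sumℚ (map f (cube k))

sumZ : {k : ℕ} → Vec Bool k → ℤ
sumZ []       = + 0
sumZ (b ∷ bs) = sgnℤ b ℤ.+ sumZ bs

-- Thr_k^θ(z) = 1  iff  Σ_i z_i ≥ θ   (as a predicate: the set Thr^{-1}(1))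
Thr : (k : ℕ) → ℤ → Vec Bool k → Set
Thr k θ z = θ ℤ.≤ sumZ z

size : {k : ℕ} → Vec Bool k → ℕ
size []           = 0
size (true ∷ bs)  = suc (size bs)
size (false ∷ bs) = size bs

χ : {k : ℕ} → Vec Bool k → Vec Bool k → ℚ
χ []           []       = 1ℚ
χ (true ∷ S)  (b ∷ z)   = sgnℚ b * χ S z
χ (false ∷ S) (b ∷ z)   = χ S z

-- A multilinear polynomial on {-1,1}^k, given by its Fourier coefficients Q̂(S).
MultilinPoly : ℕ → Set
MultilinPoly k = Vec Bool k → ℚ

eval : {k : ℕ} → MultilinPoly k → Vec Bool k → ℚ
eval {k} Q z = Σcube k (λ S → Q S * χ S z)

DegreeAtMost : {k : ℕ} → ℕ → MultilinPoly k → Set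
DegreeAtMost d Q = ∀ S → ¬ (Q S ≡ 0ℚ) → size S ℕ.≤ d

∅ : {k : ℕ} → Vec Bool k
∅ {zero}  = []
∅ {suc k} = false ∷ ∅

Separates : {k : ℕ} → ℚ → MultilinPoly k → (Vec Bool k → Set) → Set
Separates δ Q P =
  (0ℚ < δ) × (δ < 1ℚ)
  × (∀ z → δ - 1ℚ ≤ eval Q z)
  × (∀ z → P z → δ ≤ eval Q z)
  × (Q ∅ ≡ 0ℚ)

agree : {k : ℕ} → Vec Bool k → Vec Bool k → Vec Bool k → Bool
agree []          []       []       = true
agree (true ∷ T)  (a ∷ w)  (b ∷ z)  with a | b
... | true  | true  = agree T w z
... | false | false = agree T w z
... | _     | _     = false
agree (false ∷ T) (_ ∷ w)  (_ ∷ z)  = agree T w z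

marginal : {k : ℕ} → (Vec Bool k → ℚ) → Vec Bool k → Vec Bool k → ℚ
marginal {k} μ T w = Σcube k (λ z → if agree T w z then μ z else 0ℚ)

IsDistribution : {k : ℕ} → (Vec Bool k → ℚ) → Set
IsDistribution {k} μ = (∀ z → 0ℚ ≤ μ z) × (Σcube k μ ≡ 1ℚ)

TWiseUniform : {k : ℕ} → ℕ → (Vec Bool k → ℚ) → Set
TWiseUniform t μ =
  ∀ T → size T ≡ t → ∀ w → marginal μ T w * ((+ (2 ℕ.^ t)) ℚ./ 1) ≡ 1ℚ

SupportsTWise : {k : ℕ} → ℕ → (Vec Bool k → Set) → Set
SupportsTWise {k} t P =
  Data.Product.Σ (Vec Bool k → ℚ) λ μ →
    IsDistribution μ × TWiseUniform t μ × (∀ z → ¬ (μ z ≡ 0ℚ) → P z)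

{-# OPTIONS --safe #-}
module Submission where

-- Let s = z₁ + ⋯ + z_k. On {-1,1}^k the elementary symmetric polynomials e₁, e₂, e₃ are
-- polynomials in s, so the cubic p(s) = (s + 2)(s² − (k + 2)s + k²/2) is a multilinear
-- polynomial of degree 3, and its expansion has no constant term. Completing the square,
-- the quadratic factor is at least 1/4 once k ≥ 5; hence p ≥ 1/4 on Thr (where s ≥ −1),
-- while p ≥ 1/4 − 4k³ for all s ≥ −k, and p/(4k³) separates Thr with δ = 1/(16k³).
-- Conversely, under a 3-wise uniform distribution every character of degree 1 to 3 has
-- mean zero (extend its support to a 3-set T and average against the uniform marginal
-- on T), so a separating polynomial of degree 3 would have mean both 0 and at least δ.

open import Defs
open import Agda.Builtin.FromNat using (Number; fromNat)
open import Algebra.Bundles using (CommutativeMonoid)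
import Algebra.Properties.CommutativeSemigroup as CommSemigroupProperties
open import Data.Bool using (Bool; true; false; if_then_else_; f≤t; b≤b)
import Data.Bool as Bool
open import Data.Empty using (⊥-elim)
open import Data.Integer as ℤ using (+_; -[1+_]; +[1+_])
import Data.Integer.Properties as ℤₚ
open import Data.List using (List; []; _∷_; map; _++_)
open import Data.List.Properties using (map-cong; map-∘)
open import Data.Nat as ℕ using (ℕ; zero; suc; _%_; _^_; z≤n; s≤s)
open import Data.Nat.Literals using () renaming (number to ℕ-literals)
import Data.Nat.Properties as ℕₚ
open import Data.Product using (Σ; _×_; _,_)
open import Data.Rational as ℚ using
  ( ℚ; 0ℚ; 1ℚ; _<_; _≤_; _*_; _/_; _+_; _-_; -_; ½; 1/_; *≤*
  ; Positive; NonNegative; NonZero; positive; nonNegative; nonPositive)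
open import Algebra.Definitions.RawSemiring ℚ.+-*-rawSemiring using () renaming (_^_ to _^ᵠ_)
open import Data.Rational.Literals using (fromℤ) renaming (number to ℚ-literals)
open import Data.Rational.Properties
open import Data.Rational.Unnormalised.Base using (*≡*)
import Data.Rational.Unnormalised.Properties as ℚᵘ
open import Data.Sum using (inj₁; inj₂)
open import Data.Unit using (tt)
open import Data.Vec using (Vec; []; _∷_)
open import Data.Vec.Relation.Binary.Pointwise.Inductive using (Pointwise; []; _∷_)
open import Level using (0ℓ)
open import Relation.Binary.PropositionalEquality
open import Relation.Nullary using (¬_; yes; no)
open import Relation.Nullary.Decidable using (dec⇒maybe; toWitness)
open import Tactic.RingSolver using (solve-∀)
open import Tactic.RingSolver.Core.AlmostCommutativeRing using (AlmostCommutativeRing; fromCommutativeRing)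

instance
  ℕ-number : Number ℕ
  ℕ-number = ℕ-literals

  ℚ-number : Number ℚ
  ℚ-number = ℚ-literals

ℚ-ring : AlmostCommutativeRing 0ℓ 0ℓ
ℚ-ring = fromCommutativeRing +-*-commutativeRing (λ x → dec⇒maybe (0ℚ ≟ x))

open CommSemigroupProperties (CommutativeMonoid.commutativeSemigroup +-0-commutativeMonoid)
  using (interchange)
open CommSemigroupProperties (CommutativeMonoid.commutativeSemigroup *-1-commutativeMonoid)
  using (x∙yz≈y∙xz)

∑ : {A : Set} → List A → (A → ℚ) → ℚ
∑ xs f = sumℚ (map f xs)

module _ {A : Set} where

  ∑-cong : ∀ xs {f g : A → ℚ} → (∀ x → f x ≡ g x) → ∑ xs f ≡ ∑ xs g
  ∑-cong xs f≗g = cong sumℚ (map-cong f≗g xs)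

  ∑-++ : ∀ xs ys (f : A → ℚ) → ∑ (xs ++ ys) f ≡ ∑ xs f + ∑ ys f
  ∑-++ []       ys f = sym (+-identityˡ (∑ ys f))
  ∑-++ (x ∷ xs) ys f = trans (cong (_+_ (f x)) (∑-++ xs ys f)) (sym (+-assoc (f x) (∑ xs f) (∑ ys f)))

  ∑-map : ∀ {B : Set} (h : B → A) xs (f : A → ℚ) → ∑ (map h xs) f ≡ ∑ xs (λ x → f (h x))
  ∑-map h xs f = cong sumℚ (sym (map-∘ xs))

  ∑-0 : ∀ xs → ∑ xs (λ (_ : A) → 0ℚ) ≡ 0ℚ
  ∑-0 []       = refl
  ∑-0 (x ∷ xs) = trans (+-identityˡ _) (∑-0 xs)

  ∑-+ : ∀ xs (f g : A → ℚ) → ∑ xs (λ x → f x + g x) ≡ ∑ xs f + ∑ xs g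
  ∑-+ []       f g = refl
  ∑-+ (x ∷ xs) f g =
    trans (cong (_+_ (f x + g x)) (∑-+ xs f g)) (interchange (f x) (g x) (∑ xs f) (∑ xs g))

  ∑-*ˡ : ∀ xs c (f : A → ℚ) → ∑ xs (λ x → c * f x) ≡ c * ∑ xs f
  ∑-*ˡ []       c f = sym (*-zeroʳ c)
  ∑-*ˡ (x ∷ xs) c f =
    trans (cong (_+_ (c * f x)) (∑-*ˡ xs c f)) (sym (*-distribˡ-+ c (f x) (∑ xs f)))

  ∑-*ʳ : ∀ xs c (f : A → ℚ) → ∑ xs (λ x → f x * c) ≡ ∑ xs f * c
  ∑-*ʳ xs c f = trans (∑-cong xs (λ x → *-comm (f x) c)) (trans (∑-*ˡ xs c f) (*-comm c (∑ xs f)))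

  ∑-mono-≤ : ∀ xs {f g : A → ℚ} → (∀ x → f x ≤ g x) → ∑ xs f ≤ ∑ xs g
  ∑-mono-≤ []       f≤g = ≤-refl
  ∑-mono-≤ (x ∷ xs) f≤g = +-mono-≤ (f≤g x) (∑-mono-≤ xs f≤g)

∑-comm : ∀ {A B : Set} xs ys (h : A → B → ℚ) →
  ∑ xs (λ x → ∑ ys (h x)) ≡ ∑ ys (λ y → ∑ xs (λ x → h x y))
∑-comm []       ys h = sym (∑-0 ys)
∑-comm (x ∷ xs) ys h = trans (cong (_+_ (∑ ys (h x))) (∑-comm xs ys h))
  (sym (∑-+ ys (h x) (λ y → ∑ xs (λ x′ → h x′ y))))

Σcube-∷ : ∀ k (f : Vec Bool (suc k) → ℚ) →
  Σcube (suc k) f ≡ Σcube k (λ w → f (true ∷ w)) + Σcube k (λ w → f (false ∷ w))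
Σcube-∷ k f = trans (∑-++ (map (true ∷_) (cube k)) (map (false ∷_) (cube k)) f)
  (cong₂ _+_ (∑-map (true ∷_) (cube k) f) (∑-map (false ∷_) (cube k) f))

*-if0 : ∀ b c x → c * (if b then x else 0ℚ) ≡ (if b then c * x else 0ℚ)
*-if0 true  c x = refl
*-if0 false c x = *-zeroʳ c

*-if0-swap : ∀ b c x → c * (if b then x else 0ℚ) ≡ (if b then c else 0ℚ) * x
*-if0-swap true  c x = refl
*-if0-swap false c x = trans (*-zeroʳ c) (sym (*-zeroˡ x))

fromℤ≡/1 : ∀ i → fromℤ i ≡ i / 1
fromℤ≡/1 i = sym (↥p/↧p≡p (fromℤ i))

fromℤ-+ : ∀ i j → fromℤ (i ℤ.+ j) ≡ fromℤ i + fromℤ j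
fromℤ-+ i j = toℚᵘ-injective (ℚᵘ.≃-sym (ℚᵘ.≃-trans (toℚᵘ-homo-+ (fromℤ i) (fromℤ j))
  (*≡* (cong (ℤ._* + 1) (cong₂ ℤ._+_ (ℤₚ.*-identityʳ i) (ℤₚ.*-identityʳ j))))))

fromℤ-* : ∀ i j → fromℤ (i ℤ.* j) ≡ fromℤ i * fromℤ j
fromℤ-* i j = toℚᵘ-injective (ℚᵘ.≃-sym (toℚᵘ-homo-* (fromℤ i) (fromℤ j)))

fromℤ-neg : ∀ i → fromℤ (ℤ.- i) ≡ - fromℤ i
fromℤ-neg (+ zero)   = refl
fromℤ-neg +[1+ n ]   = refl
fromℤ-neg -[1+ n ]   = refl

fromℤ-mono-≤ : ∀ {i j} → i ℤ.≤ j → fromℤ i ≤ fromℤ j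
fromℤ-mono-≤ i≤j = *≤* (ℤₚ.*-monoʳ-≤-nonNeg (+ 1) i≤j)

fromℤ-pos-^ : ∀ n m → fromℤ (+ (n ^ m)) ≡ fromℤ (+ n) ^ᵠ m
fromℤ-pos-^ n zero    = refl
fromℤ-pos-^ n (suc m) = begin
  fromℤ (+ (n ℕ.* n ^ m))        ≡⟨ cong fromℤ (ℤₚ.pos-* n (n ^ m)) ⟩
  fromℤ (+ n ℤ.* + (n ^ m))      ≡⟨ fromℤ-* (+ n) (+ (n ^ m)) ⟩
  fromℤ (+ n) * fromℤ (+ (n ^ m)) ≡⟨ cong (fromℤ (+ n) *_) (fromℤ-pos-^ n m) ⟩
  fromℤ (+ n) * fromℤ (+ n) ^ᵠ m  ∎
  where open ≡-Reasoning

p≤q⇒0≤q-p : ∀ {p q} → p ≤ q → 0ℚ ≤ q - p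
p≤q⇒0≤q-p {p} {q} p≤q = subst (_≤ q - p) (+-inverseʳ p) (+-monoˡ-≤ (- p) p≤q)

p≤p+q : ∀ p {q} → 0ℚ ≤ q → p ≤ p + q
p≤p+q p {q} 0≤q = subst (_≤ p + q) (+-identityʳ p) (+-monoʳ-≤ p 0≤q)

-- Unlike +-mono-≤, this lets p and q be inferred from p + q.
+-nonNeg : ∀ {p q} → 0ℚ ≤ p → 0ℚ ≤ q → 0ℚ ≤ p + q
+-nonNeg = +-mono-≤

*-nonNeg : ∀ {p q} → 0ℚ ≤ p → 0ℚ ≤ q → 0ℚ ≤ p * q
*-nonNeg {p} {q} 0≤p 0≤q =
  nonNegative⁻¹ (p * q) {{nonNeg*nonNeg⇒nonNeg p {{nonNegative 0≤p}} q {{nonNegative 0≤q}}}}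

square-nonNeg : ∀ p → 0ℚ ≤ p * p
square-nonNeg p with ≤-total 0ℚ p
... | inj₁ 0≤p = *-nonNeg 0≤p 0≤p
... | inj₂ p≤0 =
  -- The library lemma nonPos*nonPos⇒nonPos concludes NonNegative, despite its name.
  nonNegative⁻¹ (p * p) {{nonPos*nonPos⇒nonPos p {{nonPositive p≤0}} p {{nonPositive p≤0}}}}

1≤* : ∀ {p q} → 1ℚ ≤ p → 1ℚ ≤ q → 1ℚ ≤ p * q
1≤* {p} {q} 1≤p 1≤q = begin
  1ℚ      ≤⟨ 1≤q ⟩
  q       ≡⟨ *-identityˡ q ⟨
  1ℚ * q  ≤⟨ *-monoʳ-≤-nonNeg q {{nonNegative (≤-trans (nonNegative⁻¹ 1ℚ) 1≤q)}} 1≤p ⟩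
  p * q   ∎
  where open ≤-Reasoning


-- Symmetric multilinear polynomials

levelPoly : ∀ {k} → (ℕ → ℚ) → MultilinPoly k
levelPoly f S = f (size S)

eval-levelPoly-∷ : ∀ {n} (f : ℕ → ℚ) b (z : Vec Bool n) →
  eval (levelPoly f) (b ∷ z) ≡ sgnℚ b * eval (levelPoly (λ m → f (suc m))) z + eval (levelPoly f) z
eval-levelPoly-∷ {n} f b z = trans (Σcube-∷ n (λ S → f (size S) * χ S (b ∷ z)))
  (cong (_+ eval (levelPoly f) z)
    (trans (∑-cong (cube n) (λ S → x∙yz≈y∙xz (f (suc (size S))) (sgnℚ b) (χ S z)))
           (∑-*ˡ (cube n) (sgnℚ b) (λ S → f (suc (size S)) * χ S z))))

-- Levels 0 to 3 carry d, a, b, c; shifting by one level gives cubicLevels a b c 0ℚ by definition.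
cubicLevels : ℚ → ℚ → ℚ → ℚ → ℕ → ℚ
cubicLevels d a b c zero    = d
cubicLevels d a b c (suc m) = cubicLevels a b c 0ℚ m

cubicLevels-degree : ∀ {k} d a b c → DegreeAtMost {k} 3 (levelPoly (cubicLevels d a b c))
cubicLevels-degree d a b c S ≢0 with size S
... | zero                      = z≤n
... | suc zero                  = s≤s z≤n
... | suc (suc zero)            = s≤s (s≤s z≤n)
... | suc (suc (suc zero))      = s≤s (s≤s (s≤s z≤n))
... | suc (suc (suc (suc m)))   = ⊥-elim (≢0 (vanishes m))
  where
  vanishes : ∀ m → cubicLevels 0ℚ 0ℚ 0ℚ 0ℚ m ≡ 0ℚ
  vanishes zero    = refl
  vanishes (suc m) = vanishes m

-- e₂ and e₃ of N signs with sum s (using z² = 1).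
e₂ e₃ : ℚ → ℚ → ℚ
e₂ s N = ½ * (s * s - N)
e₃ s N = 1/ 6 * (s * s * s - (3 * N - 2) * s)

e₂-∷ : ∀ x s N → e₂ (sgnℚ x + s) (1 + N) ≡ sgnℚ x * s + e₂ s N
e₂-∷ true  = identity
  where
  identity : ∀ s N → ½ * ((1 + s) * (1 + s) - (1 + N)) ≡ 1 * s + ½ * (s * s - N)
  identity = solve-∀ ℚ-ring
e₂-∷ false = identity
  where
  identity : ∀ s N → ½ * ((- 1 + s) * (- 1 + s) - (1 + N)) ≡ - 1 * s + ½ * (s * s - N)
  identity = solve-∀ ℚ-ring

e₃-∷ : ∀ x s N → e₃ (sgnℚ x + s) (1 + N) ≡ sgnℚ x * e₂ s N + e₃ s N
e₃-∷ true  = identity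
  where
  identity : ∀ s N → 1/ 6 * ((1 + s) * (1 + s) * (1 + s) - (3 * (1 + N) - 2) * (1 + s))
                   ≡ 1 * (½ * (s * s - N)) + 1/ 6 * (s * s * s - (3 * N - 2) * s)
  identity = solve-∀ ℚ-ring
e₃-∷ false = identity
  where
  identity : ∀ s N → 1/ 6 * ((- 1 + s) * (- 1 + s) * (- 1 + s) - (3 * (1 + N) - 2) * (- 1 + s))
                   ≡ - 1 * (½ * (s * s - N)) + 1/ 6 * (s * s * s - (3 * N - 2) * s)
  identity = solve-∀ ℚ-ring

symmetricCubic : ℚ → ℚ → ℚ → ℚ → ℚ → ℚ → ℚ
symmetricCubic d a b c s N = d + a * s + b * e₂ s N + c * e₃ s N

symmetricCubic-∷ : ∀ x d a b c s N →
  symmetricCubic d a b c (sgnℚ x + s) (1 + N)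
    ≡ sgnℚ x * symmetricCubic a b c 0ℚ s N + symmetricCubic d a b c s N
symmetricCubic-∷ x d a b c s N = begin
  d + a * (σ + s) + b * e₂ (σ + s) (1 + N) + c * e₃ (σ + s) (1 + N)
    ≡⟨ cong₂ (λ u v → d + a * (σ + s) + b * u + c * v) (e₂-∷ x s N) (e₃-∷ x s N) ⟩
  d + a * (σ + s) + b * (σ * s + e₂ s N) + c * (σ * e₂ s N + e₃ s N)
    ≡⟨ regroup σ d a b c s (e₂ s N) (e₃ s N) ⟩
  σ * (a + b * s + c * e₂ s N + 0ℚ * e₃ s N) + (d + a * s + b * e₂ s N + c * e₃ s N) ∎
  where
  open ≡-Reasoning
  σ : ℚ
  σ = sgnℚ x
  regroup : ∀ σ d a b c s E₂ E₃ →
    d + a * (σ + s) + b * (σ * s + E₂) + c * (σ * E₂ + E₃)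
      ≡ σ * (a + b * s + c * E₂ + 0ℚ * E₃) + (d + a * s + b * E₂ + c * E₃)
  regroup = solve-∀ ℚ-ring

fromℤ-sgn : ∀ x → fromℤ (sgnℤ x) ≡ sgnℚ x
fromℤ-sgn true  = refl
fromℤ-sgn false = refl

eval-cubicLevels : ∀ {n} d a b c (z : Vec Bool n) →
  eval (levelPoly (cubicLevels d a b c)) z ≡ symmetricCubic d a b c (fromℤ (sumZ z)) (fromℤ (+ n))
eval-cubicLevels d a b c [] = base d a b c
  where
  base : ∀ d a b c → d * 1 + 0ℚ ≡ d + a * 0ℚ + b * 0ℚ + c * 0ℚ
  base = solve-∀ ℚ-ring
eval-cubicLevels {suc n} d a b c (x ∷ z) = begin
  eval (levelPoly (cubicLevels d a b c)) (x ∷ z)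
    ≡⟨ eval-levelPoly-∷ (cubicLevels d a b c) x z ⟩
  sgnℚ x * eval (levelPoly (cubicLevels a b c 0ℚ)) z + eval (levelPoly (cubicLevels d a b c)) z
    ≡⟨ cong₂ (λ u v → sgnℚ x * u + v) (eval-cubicLevels a b c 0ℚ z) (eval-cubicLevels d a b c z) ⟩
  sgnℚ x * symmetricCubic a b c 0ℚ s N + symmetricCubic d a b c s N
    ≡⟨ symmetricCubic-∷ x d a b c s N ⟨
  symmetricCubic d a b c (sgnℚ x + s) (1 + N)
    ≡⟨ cong₂ (symmetricCubic d a b c)
         (trans (fromℤ-+ (sgnℤ x) (sumZ z)) (cong (_+ s) (fromℤ-sgn x)))
         (fromℤ-+ (+ 1) (+ n)) ⟨
  symmetricCubic d a b c (fromℤ (sumZ (x ∷ z))) (fromℤ (+ suc n)) ∎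
  where
  open ≡-Reasoning
  s N : ℚ
  s = fromℤ (sumZ z)
  N = fromℤ (+ n)

-- Characters, marginals and t-wise uniformity

𝔼 : ∀ {k} → (Vec Bool k → ℚ) → (Vec Bool k → ℚ) → ℚ
𝔼 {k} μ f = Σcube k (λ z → μ z * f z)

_⊆_ : ∀ {n} → Vec Bool n → Vec Bool n → Set
_⊆_ = Pointwise Bool._≤_

-- 2 ^ (number of coordinates outside T): the number of points agreeing with a given one on T.
fibreSize : ∀ {n} → Vec Bool n → ℚ
fibreSize []          = 1ℚ
fibreSize (true ∷ T)  = fibreSize T
fibreSize (false ∷ T) = fibreSize T + fibreSize T

fibreSize-positive : ∀ {n} (T : Vec Bool n) → Positive (fibreSize T)
fibreSize-positive []          = _
fibreSize-positive (true ∷ T)  = fibreSize-positive T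
fibreSize-positive (false ∷ T) =
  pos+pos⇒pos (fibreSize T) {{fibreSize-positive T}} (fibreSize T) {{fibreSize-positive T}}

Σcube-agree-fixed : ∀ {n} (T : Vec Bool n) x z (g : Vec Bool (suc n) → ℚ) →
  Σcube (suc n) (λ w → if agree (true ∷ T) w (x ∷ z) then g w else 0ℚ)
    ≡ Σcube n (λ w → if agree T w z then g (x ∷ w) else 0ℚ)
Σcube-agree-fixed {n} T true z g =
  trans (Σcube-∷ n _) (trans (cong (_+_ fixed) (∑-0 (cube n))) (+-identityʳ fixed))
  where
  fixed : ℚ
  fixed = Σcube n (λ w → if agree T w z then g (true ∷ w) else 0ℚ)
Σcube-agree-fixed {n} T false z g =
  trans (Σcube-∷ n _) (trans (cong (_+ fixed) (∑-0 (cube n))) (+-identityˡ fixed))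
  where
  fixed : ℚ
  fixed = Σcube n (λ w → if agree T w z then g (false ∷ w) else 0ℚ)

Σcube-agree-χ : ∀ {n} {S T : Vec Bool n} → S ⊆ T → ∀ z →
  Σcube n (λ w → if agree T w z then χ S w else 0ℚ) ≡ fibreSize T * χ S z
Σcube-agree-χ [] [] = refl
Σcube-agree-χ {suc n} {true ∷ S} {true ∷ T} (b≤b ∷ S⊆T) (x ∷ z) = begin
  Σcube (suc n) (λ w → if agree (true ∷ T) w (x ∷ z) then χ (true ∷ S) w else 0ℚ)
    ≡⟨ Σcube-agree-fixed T x z (χ (true ∷ S)) ⟩
  Σcube n (λ w → if agree T w z then sgnℚ x * χ S w else 0ℚ)
    ≡⟨ ∑-cong (cube n) (λ w → *-if0 (agree T w z) (sgnℚ x) (χ S w)) ⟨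
  Σcube n (λ w → sgnℚ x * (if agree T w z then χ S w else 0ℚ))
    ≡⟨ ∑-*ˡ (cube n) (sgnℚ x) _ ⟩
  sgnℚ x * Σcube n (λ w → if agree T w z then χ S w else 0ℚ)
    ≡⟨ cong (sgnℚ x *_) (Σcube-agree-χ S⊆T z) ⟩
  sgnℚ x * (fibreSize T * χ S z)
    ≡⟨ x∙yz≈y∙xz (sgnℚ x) (fibreSize T) (χ S z) ⟩
  fibreSize T * (sgnℚ x * χ S z) ∎
  where open ≡-Reasoning
Σcube-agree-χ {suc n} {false ∷ S} {false ∷ T} (b≤b ∷ S⊆T) (x ∷ z) =
  trans (Σcube-∷ n _) (trans (cong₂ _+_ (Σcube-agree-χ S⊆T z) (Σcube-agree-χ S⊆T z))
    (sym (*-distribʳ-+ (χ S z) (fibreSize T) (fibreSize T))))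
Σcube-agree-χ {suc n} {false ∷ S} {true ∷ T} (f≤t ∷ S⊆T) (x ∷ z) =
  trans (Σcube-agree-fixed T x z (χ (false ∷ S))) (Σcube-agree-χ S⊆T z)

Σcube-χ≡0 : ∀ {n} (S : Vec Bool n) → 1 ℕ.≤ size S → Σcube n (χ S) ≡ 0ℚ
Σcube-χ≡0 {suc n} (true ∷ S) _ = begin
  Σcube (suc n) (χ (true ∷ S))
    ≡⟨ Σcube-∷ n (χ (true ∷ S)) ⟩
  Σcube n (λ w → 1 * χ S w) + Σcube n (λ w → - 1 * χ S w)
    ≡⟨ cong₂ _+_ (∑-*ˡ (cube n) 1 (χ S)) (∑-*ˡ (cube n) (- 1) (χ S)) ⟩
  1 * Σcube n (χ S) + - 1 * Σcube n (χ S)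
    ≡⟨ cancel (Σcube n (χ S)) ⟩
  0ℚ ∎
  where
  open ≡-Reasoning
  cancel : ∀ X → 1 * X + - 1 * X ≡ 0ℚ
  cancel = solve-∀ ℚ-ring
Σcube-χ≡0 {suc n} (false ∷ S) 1≤|S| =
  trans (Σcube-∷ n (χ (false ∷ S))) (cong₂ _+_ (Σcube-χ≡0 S 1≤|S|) (Σcube-χ≡0 S 1≤|S|))

marginal-moment : ∀ {k} (μ : Vec Bool k → ℚ) {S T : Vec Bool k} → S ⊆ T →
  fibreSize T * 𝔼 μ (χ S) ≡ Σcube k (λ w → marginal μ T w * χ S w)
marginal-moment {k} μ {S} {T} S⊆T = begin
  fibreSize T * Σcube k (λ z → μ z * χ S z)
    ≡⟨ ∑-*ˡ (cube k) (fibreSize T) _ ⟨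
  Σcube k (λ z → fibreSize T * (μ z * χ S z))
    ≡⟨ ∑-cong (cube k) (λ z → x∙yz≈y∙xz (fibreSize T) (μ z) (χ S z)) ⟩
  Σcube k (λ z → μ z * (fibreSize T * χ S z))
    ≡⟨ ∑-cong (cube k) (λ z → cong (μ z *_) (Σcube-agree-χ S⊆T z)) ⟨
  Σcube k (λ z → μ z * Σcube k (λ w → if agree T w z then χ S w else 0ℚ))
    ≡⟨ ∑-cong (cube k) (λ z → trans (sym (∑-*ˡ (cube k) (μ z) _))
         (∑-cong (cube k) (λ w → *-if0-swap (agree T w z) (μ z) (χ S w)))) ⟩
  Σcube k (λ z → Σcube k (λ w → (if agree T w z then μ z else 0ℚ) * χ S w))
    ≡⟨ ∑-comm (cube k) (cube k) _ ⟩
  Σcube k (λ w → Σcube k (λ z → (if agree T w z then μ z else 0ℚ) * χ S w))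
    ≡⟨ ∑-cong (cube k) (λ w → ∑-*ʳ (cube k) (χ S w) _) ⟩
  Σcube k (λ w → marginal μ T w * χ S w) ∎
  where open ≡-Reasoning

size≤length : ∀ {n} (S : Vec Bool n) → size S ℕ.≤ n
size≤length []          = z≤n
size≤length (true ∷ S)  = s≤s (size≤length S)
size≤length (false ∷ S) = ℕₚ.m≤n⇒m≤1+n (size≤length S)

⊆-extend : ∀ {n} (S : Vec Bool n) {m} → size S ℕ.≤ m → m ℕ.≤ n →
  Σ (Vec Bool n) λ T → S ⊆ T × size T ≡ m
⊆-extend [] {zero} _ _ = [] , [] , refl
⊆-extend (true ∷ S) {suc m} (s≤s |S|≤m) (s≤s m≤n) =
  let T , S⊆T , |T|≡m = ⊆-extend S |S|≤m m≤n in true ∷ T , b≤b ∷ S⊆T , cong suc |T|≡m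
⊆-extend {suc n} (false ∷ S) {m} |S|≤m m≤1+n with m ℕₚ.≤? n
... | yes m≤n = let T , S⊆T , |T|≡m = ⊆-extend S |S|≤m m≤n in false ∷ T , b≤b ∷ S⊆T , |T|≡m
... | no  m≰n = let T , S⊆T , |T|≡n = ⊆-extend S (size≤length S) ℕₚ.≤-refl in
  true ∷ T , f≤t ∷ S⊆T , trans (cong suc |T|≡n) (ℕₚ.≤-antisym (ℕₚ.≰⇒> m≰n) m≤1+n)

pos*x≡0⇒x≡0 : ∀ c .{{_ : Positive c}} {x} → c * x ≡ 0ℚ → x ≡ 0ℚ
pos*x≡0⇒x≡0 c c*x≡0 = ≤-antisym
  (*-cancelˡ-≤-pos c (≤-reflexive (trans c*x≡0 (sym (*-zeroʳ c)))))
  (*-cancelˡ-≤-pos c (≤-reflexive (trans (*-zeroʳ c) (sym c*x≡0))))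

Σmarginal-χ≡0 : ∀ {k t} {μ : Vec Bool k → ℚ} {S T : Vec Bool k} → TWiseUniform t μ →
  size T ≡ t → 1 ℕ.≤ size S → Σcube k (λ w → marginal μ T w * χ S w) ≡ 0ℚ
Σmarginal-χ≡0 {k} {t} {μ} {S} {T} uniform |T|≡t 1≤|S| = pos*x≡0⇒x≡0 2^t (begin
  2^t * Σcube k (λ w → marginal μ T w * χ S w)
    ≡⟨ ∑-*ˡ (cube k) 2^t _ ⟨
  Σcube k (λ w → 2^t * (marginal μ T w * χ S w))
    ≡⟨ ∑-cong (cube k) (λ w → trans (sym (*-assoc 2^t (marginal μ T w) (χ S w)))
         (trans (cong (_* χ S w) (trans (*-comm 2^t _) (uniform T |T|≡t w))) (*-identityˡ (χ S w)))) ⟩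
  Σcube k (χ S)
    ≡⟨ Σcube-χ≡0 S 1≤|S| ⟩
  0ℚ ∎)
  where
  open ≡-Reasoning
  2^t : ℚ
  2^t = + (2 ^ t) / 1
  instance
    2^t-positive : Positive 2^t
    2^t-positive = normalize-pos (2 ^ t) 1 {{_}} {{ℕₚ.m^n≢0 2 t}}

moment-vanishes : ∀ {k t} {μ : Vec Bool k → ℚ} (S : Vec Bool k) → TWiseUniform t μ →
  1 ℕ.≤ size S → size S ℕ.≤ t → t ℕ.≤ k → 𝔼 μ (χ S) ≡ 0ℚ
moment-vanishes {μ = μ} S uniform 1≤|S| |S|≤t t≤k with ⊆-extend S |S|≤t t≤k
... | T , S⊆T , |T|≡t = pos*x≡0⇒x≡0 (fibreSize T) {{fibreSize-positive T}}
  (trans (marginal-moment μ S⊆T) (Σmarginal-χ≡0 {S = S} {T} uniform |T|≡t 1≤|S|))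

size≡0⇒∅ : ∀ {n} (S : Vec Bool n) → size S ≡ 0 → S ≡ ∅
size≡0⇒∅ []          _     = refl
size≡0⇒∅ (false ∷ S) |S|≡0 = cong (false ∷_) (size≡0⇒∅ S |S|≡0)

mean-vanishes : ∀ {k t} {μ : Vec Bool k → ℚ} {Q : MultilinPoly k} → TWiseUniform t μ →
  t ℕ.≤ k → DegreeAtMost t Q → Q ∅ ≡ 0ℚ → 𝔼 μ (eval Q) ≡ 0ℚ
mean-vanishes {k} {μ = μ} {Q} uniform t≤k deg Q∅≡0 = begin
  Σcube k (λ z → μ z * Σcube k (λ S → Q S * χ S z))
    ≡⟨ ∑-cong (cube k) (λ z → ∑-*ˡ (cube k) (μ z) _) ⟨
  Σcube k (λ z → Σcube k (λ S → μ z * (Q S * χ S z)))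
    ≡⟨ ∑-comm (cube k) (cube k) _ ⟩
  Σcube k (λ S → Σcube k (λ z → μ z * (Q S * χ S z)))
    ≡⟨ ∑-cong (cube k) (λ S → trans (∑-cong (cube k) (λ z → x∙yz≈y∙xz (μ z) (Q S) (χ S z)))
                                    (∑-*ˡ (cube k) (Q S) _)) ⟩
  Σcube k (λ S → Q S * 𝔼 μ (χ S))
    ≡⟨ ∑-cong (cube k) term≡0 ⟩
  Σcube k (λ _ → 0ℚ)
    ≡⟨ ∑-0 (cube k) ⟩
  0ℚ ∎
  where
  open ≡-Reasoning
  term≡0 : ∀ S → Q S * 𝔼 μ (χ S) ≡ 0ℚ
  term≡0 S with Q S ≟ 0ℚ | size S in |S|≡
  ... | yes Q̂≡0 | _     = trans (cong (_* 𝔼 μ (χ S)) Q̂≡0) (*-zeroˡ (𝔼 μ (χ S)))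
  ... | no  Q̂≢0 | zero  = ⊥-elim (Q̂≢0 (trans (cong Q (size≡0⇒∅ S |S|≡)) Q∅≡0))
  ... | no  Q̂≢0 | suc _ = trans (cong (Q S *_) (moment-vanishes S uniform
      (subst (1 ℕ.≤_) (sym |S|≡) (s≤s z≤n)) (deg S Q̂≢0) t≤k)) (*-zeroʳ (Q S))

𝔼-≥ : ∀ {k} {μ f : Vec Bool k → ℚ} {P : Vec Bool k → Set} {c} → IsDistribution μ →
  (∀ z → ¬ μ z ≡ 0ℚ → P z) → (∀ z → P z → c ≤ f z) → c ≤ 𝔼 μ f
𝔼-≥ {k} {μ} {f} {c = c} (μ≥0 , Σμ≡1) supp⊆P f≥c = begin
  c                           ≡⟨ *-identityˡ c ⟨
  1ℚ * c                      ≡⟨ cong (_* c) Σμ≡1 ⟨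
  Σcube k μ * c               ≡⟨ ∑-*ʳ (cube k) c μ ⟨
  Σcube k (λ z → μ z * c)     ≤⟨ ∑-mono-≤ (cube k) pointwise ⟩
  Σcube k (λ z → μ z * f z)   ∎
  where
  open ≤-Reasoning
  pointwise : ∀ z → μ z * c ≤ μ z * f z
  pointwise z with μ z ≟ 0ℚ
  ... | yes μz≡0 = ≤-reflexive (trans (cong (_* c) μz≡0)
                   (trans (*-zeroˡ c) (sym (trans (cong (_* f z) μz≡0) (*-zeroˡ (f z))))))
  ... | no  μz≢0 = *-monoˡ-≤-nonNeg (μ z) {{nonNegative (μ≥0 z)}} (f≥c z (supp⊆P z μz≢0))

separates⇒¬supportsTWise : ∀ {k t δ} {Q : MultilinPoly k} {P : Vec Bool k → Set} →
  t ℕ.≤ k → DegreeAtMost t Q → Separates δ Q P → ¬ SupportsTWise t P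
separates⇒¬supportsTWise t≤k deg (0<δ , _ , _ , Q≥δ , Q∅≡0)
                         (μ , distribution , uniform , supp⊆P) =
  <-irrefl refl (<-≤-trans 0<δ (≤-trans (𝔼-≥ distribution supp⊆P Q≥δ)
    (≤-reflexive (mean-vanishes uniform t≤k deg Q∅≡0))))

_•_ : ∀ {k} → ℚ → MultilinPoly k → MultilinPoly k
(r • Q) S = r * Q S

eval-• : ∀ {k} r (Q : MultilinPoly k) z → eval (r • Q) z ≡ r * eval Q z
eval-• {k} r Q z = trans (∑-cong (cube k) (λ S → *-assoc r (Q S) (χ S z))) (∑-*ˡ (cube k) r _)

•-degree : ∀ {k d} r {Q : MultilinPoly k} → DegreeAtMost d Q → DegreeAtMost d (r • Q)
•-degree r deg S rQ̂≢0 = deg S (λ Q̂≡0 → rQ̂≢0 (trans (cong (r *_) Q̂≡0) (*-zeroʳ r)))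

normalised-separates : ∀ {k} {P : Vec Bool k → Set} {Q : MultilinPoly k} {m D r : ℚ} →
  0ℚ < m → m < D → 0ℚ < r → r * D ≡ 1ℚ → Q ∅ ≡ 0ℚ →
  (∀ z → m - D ≤ eval Q z) → (∀ z → P z → m ≤ eval Q z) → Separates (r * m) (r • Q) P
normalised-separates {Q = Q} {m} {D} {r} 0<m m<D 0<r r*D≡1 Q∅≡0 Q≥m-D Q≥m =
  positive⁻¹ (r * m) {{pos*pos⇒pos r m}} ,
  <-≤-trans (*-monoʳ-<-pos r m<D) (≤-reflexive r*D≡1) ,
  (λ z → begin
    r * m - 1ℚ      ≡⟨ cong (_-_ (r * m)) r*D≡1 ⟨
    r * m - r * D   ≡⟨ distrib r m D ⟨
    r * (m - D)     ≤⟨ *-monoˡ-≤-nonNeg r (Q≥m-D z) ⟩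
    r * eval Q z    ≡⟨ eval-• r Q z ⟨
    eval (r • Q) z  ∎) ,
  (λ z Pz → subst (r * m ≤_) (sym (eval-• r Q z)) (*-monoˡ-≤-nonNeg r (Q≥m z Pz))) ,
  trans (cong (r *_) Q∅≡0) (*-zeroʳ r)
  where
  open ≤-Reasoning
  instance
    r-positive : Positive r
    r-positive = positive 0<r
    r-nonNegative : NonNegative r
    r-nonNegative = pos⇒nonNeg r
    m-positive : Positive m
    m-positive = positive 0<m
  distrib : ∀ r m D → r * (m - D) ≡ r * m - r * D
  distrib = solve-∀ ℚ-ring

-- The separating cubic

separatorProfile : ℚ → ℚ → ℚ
separatorProfile K s = (s + 2) * (s * s - (K + 2) * s + ½ * K * K)

quadratic-≥¼ : ∀ {K} s → 5 ≤ K → 1/ 4 ≤ s * s - (K + 2) * s + ½ * K * K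
quadratic-≥¼ {K} s 5≤K = begin
  1/ 4                                                     ≤⟨ p≤p+q (1/ 4) slack≥0 ⟩
  1/ 4 + (t * t + 1/ 4 * (K - 5) * (K + 1))                ≡⟨ complete-square s K ⟨
  s * s - (K + 2) * s + ½ * K * K                          ∎
  where
  open ≤-Reasoning
  t : ℚ
  t = s - ½ * K - 1
  slack≥0 : 0ℚ ≤ t * t + 1/ 4 * (K - 5) * (K + 1)
  slack≥0 = +-nonNeg (square-nonNeg t)
    (*-nonNeg (*-nonNeg (nonNegative⁻¹ (1/ 4)) (p≤q⇒0≤q-p 5≤K))
              (+-nonNeg (≤-trans (nonNegative⁻¹ 5) 5≤K) (nonNegative⁻¹ 1)))
  complete-square : ∀ s K → s * s - (K + 2) * s + ½ * K * K
                          ≡ 1/ 4 + ((s - ½ * K - 1) * (s - ½ * K - 1) + 1/ 4 * (K - 5) * (K + 1))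
  complete-square = solve-∀ ℚ-ring

separatorProfile-≥¼ : ∀ {K s} → 5 ≤ K → - 1 ≤ s → 1/ 4 ≤ separatorProfile K s
separatorProfile-≥¼ {K} {s} 5≤K -1≤s = begin
  1/ 4         ≤⟨ q≥¼ ⟩
  q            ≡⟨ *-identityˡ q ⟨
  1 * q        ≤⟨ *-monoʳ-≤-nonNeg q {{nonNegative 0≤q}} (+-monoˡ-≤ 2 -1≤s) ⟩
  (s + 2) * q  ∎
  where
  open ≤-Reasoning
  q : ℚ
  q = s * s - (K + 2) * s + ½ * K * K
  q≥¼ : 1/ 4 ≤ q
  q≥¼ = quadratic-≥¼ s 5≤K
  0≤q : 0ℚ ≤ q
  0≤q = ≤-trans (nonNegative⁻¹ (1/ 4)) q≥¼

separatorProfile-≥-4K³ : ∀ {K s} → 5 ≤ K → - K ≤ s → s ≤ - 2 →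
  1/ 4 - 4 * (K * K * K) ≤ separatorProfile K s
separatorProfile-≥-4K³ {K} {s} 5≤K -K≤s s≤-2 = begin
  1/ 4 - 4 * (K * K * K)                       ≤⟨ p≤p+q (1/ 4 - 4 * (K * K * K)) slack≥0 ⟩
  1/ 4 - 4 * (K * K * K) + slack               ≡⟨ certificate s K ⟨
  (s + 2) * (s * s - (K + 2) * s + ½ * K * K)  ∎
  where
  open ≤-Reasoning
  -- The slacks u, v, w are nonnegative, and the certificate is a polynomial in K, u, v, w
  -- with nonnegative coefficients.
  u v w : ℚ
  u = s - - K
  v = - 2 - s
  w = K - 5
  slack : ℚ
  slack = K * K * (3 * ½ * K + 3) + 4 * w + 79 * 1/ 4 + u * K * (5 * ½ * K + 2) + v * u * (2 * K + 4 + v)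
  0≤K : 0ℚ ≤ K
  0≤K = ≤-trans (nonNegative⁻¹ 5) 5≤K
  0≤u : 0ℚ ≤ u
  0≤u = p≤q⇒0≤q-p -K≤s
  0≤v : 0ℚ ≤ v
  0≤v = p≤q⇒0≤q-p s≤-2
  0≤cK+d : ∀ c d .{{_ : NonNegative c}} .{{_ : NonNegative d}} → 0ℚ ≤ c * K + d
  0≤cK+d c d = +-nonNeg (*-nonNeg (nonNegative⁻¹ c) 0≤K) (nonNegative⁻¹ d)
  slack≥0 : 0ℚ ≤ slack
  slack≥0 =
    +-nonNeg (+-nonNeg (+-nonNeg (+-nonNeg
      (*-nonNeg (*-nonNeg 0≤K 0≤K) (0≤cK+d (3 * ½) 3))
      (*-nonNeg (nonNegative⁻¹ 4) (p≤q⇒0≤q-p 5≤K)))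
      (nonNegative⁻¹ (79 * 1/ 4)))
      (*-nonNeg (*-nonNeg 0≤u 0≤K) (0≤cK+d (5 * ½) 2)))
      (*-nonNeg (*-nonNeg 0≤v 0≤u) (+-nonNeg (0≤cK+d 2 4) 0≤v))
  certificate : ∀ s K → (s + 2) * (s * s - (K + 2) * s + ½ * K * K)
    ≡ 1/ 4 - 4 * (K * K * K) + (K * K * (3 * ½ * K + 3) + 4 * (K - 5) + 79 * 1/ 4
        + (s - - K) * K * (5 * ½ * K + 2) + (- 2 - s) * (s - - K) * (2 * K + 4 + (- 2 - s)))
  certificate = solve-∀ ℚ-ring

separatorProfile-fromℤ-≥ : ∀ {K} i → 5 ≤ K → - K ≤ fromℤ i →
  1/ 4 - 4 * (K * K * K) ≤ separatorProfile K (fromℤ i)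
separatorProfile-fromℤ-≥ {K} i 5≤K -K≤i with i ℤ.≤? -[1+ 1 ]
... | yes i≤-2 = separatorProfile-≥-4K³ 5≤K -K≤i (fromℤ-mono-≤ i≤-2)
... | no  i≰-2 = ≤-trans (+-monoʳ-≤ (1/ 4) (neg-antimono-≤ 4K³≥0))
  (separatorProfile-≥¼ 5≤K (fromℤ-mono-≤ (ℤₚ.i<j⇒suc[i]≤j (ℤₚ.≰⇒> i≰-2))))
  where
  0≤K : 0ℚ ≤ K
  0≤K = ≤-trans (nonNegative⁻¹ 5) 5≤K
  4K³≥0 : 0ℚ ≤ 4 * (K * K * K)
  4K³≥0 = *-nonNeg (nonNegative⁻¹ 4) (*-nonNeg (*-nonNeg 0≤K 0≤K) 0≤K)

separatorLevels : ℚ → ℕ → ℚ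
separatorLevels K = cubicLevels 0ℚ (½ * K * K + K - 6) (- (2 * K)) 6

𝒫 : (k : ℕ) → MultilinPoly k
𝒫 k = levelPoly (separatorLevels (fromℤ (+ k)))

eval-𝒫 : ∀ {k} (z : Vec Bool k) → eval (𝒫 k) z ≡ separatorProfile (fromℤ (+ k)) (fromℤ (sumZ z))
eval-𝒫 {k} z = trans (eval-cubicLevels _ _ _ _ z) (expand (fromℤ (+ k)) (fromℤ (sumZ z)))
  where
  expand : ∀ K s → 0ℚ + (½ * K * K + K - 6) * s + - (2 * K) * (½ * (s * s - K))
                     + 6 * (1/ 6 * (s * s * s - (3 * K - 2) * s))
                 ≡ (s + 2) * (s * s - (K + 2) * s + ½ * K * K)
  expand = solve-∀ ℚ-ring

size-∅ : ∀ {k} → size (∅ {k}) ≡ 0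
size-∅ {zero}  = refl
size-∅ {suc k} = size-∅ {k}

sgnℤ-≥ : ∀ b → -[1+ 0 ] ℤ.≤ sgnℤ b
sgnℤ-≥ true  = ℤ.-≤+
sgnℤ-≥ false = ℤₚ.≤-refl

sumZ-≥ : ∀ {k} (z : Vec Bool k) → ℤ.- (+ k) ℤ.≤ sumZ z
sumZ-≥ []      = ℤₚ.≤-refl
sumZ-≥ {suc k} (b ∷ z) =
  subst (ℤ._≤ sumZ (b ∷ z)) (sym (ℤₚ.neg-distrib-+ (+ 1) (+ k)))
        (ℤₚ.+-mono-≤ (sgnℤ-≥ b) (sumZ-≥ z))

module _ {k : ℕ} (5≤k : 5 ℕ.≤ k) where

  private
    K : ℚ
    K = fromℤ (+ k)

    5≤K : 5 ≤ K
    5≤K = fromℤ-mono-≤ (ℤ.+≤+ 5≤k)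

  𝒫-≥ : ∀ z → 1/ 4 - 4 * (K * K * K) ≤ eval (𝒫 k) z
  𝒫-≥ z = subst (_ ≤_) (sym (eval-𝒫 z)) (separatorProfile-fromℤ-≥ (sumZ z) 5≤K
    (subst (_≤ fromℤ (sumZ z)) (fromℤ-neg (+ k)) (fromℤ-mono-≤ (sumZ-≥ z))))

  𝒫-≥¼-on-Thr : ∀ z → Thr k -[1+ 0 ] z → 1/ 4 ≤ eval (𝒫 k) z
  𝒫-≥¼-on-Thr z -1≤s =
    subst (1/ 4 ≤_) (sym (eval-𝒫 z)) (separatorProfile-≥¼ 5≤K (fromℤ-mono-≤ -1≤s))

1/16≤r/4*K⁴ : ∀ {K r} → 1ℚ ≤ K → r * (4 * (K * K * K)) ≡ 1ℚ →
  1/ 16 ≤ r * 1/ 4 * (K * (K * (K * (K * 1ℚ))))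
1/16≤r/4*K⁴ {K} {r} 1≤K r*4K³≡1 = begin
  1/ 16                                   ≤⟨ *-monoˡ-≤-nonNeg (1/ 16) 1≤K ⟩
  1/ 16 * K                               ≡⟨ *-identityʳ (1/ 16 * K) ⟨
  1/ 16 * K * 1ℚ                          ≡⟨ cong (_*_ (1/ 16 * K)) r*4K³≡1 ⟨
  1/ 16 * K * (r * (4 * (K * K * K)))     ≡⟨ rearrange r K ⟩
  r * 1/ 4 * (K * (K * (K * (K * 1ℚ))))   ∎
  where
  open ≤-Reasoning
  rearrange : ∀ r K → 1/ 16 * K * (r * (4 * (K * K * K))) ≡ r * 1/ 4 * (K * (K * (K * (K * 1ℚ))))
  rearrange = solve-∀ ℚ-ring

Thr-separable : ∀ k → 5 ℕ.≤ k → Σ ℚ λ δ → Σ (MultilinPoly k) λ Q →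
  (1/ 16 ≤ δ * ((+ (k ^ 4)) / 1)) × DegreeAtMost 3 Q × Separates δ Q (Thr k -[1+ 0 ])
Thr-separable k 5≤k =
  r * 1/ 4 , r • 𝒫 k ,
  subst (1/ 16 ≤_) (cong (_*_ (r * 1/ 4)) K⁴≡k^4/1) (1/16≤r/4*K⁴ {K} {r} 1≤K (*-inverseˡ D)) ,
  •-degree r (cubicLevels-degree _ _ _ _) ,
  normalised-separates (positive⁻¹ (1/ 4)) ¼<D (positive⁻¹ r) (*-inverseˡ D)
    (cong (separatorLevels K) (size-∅ {k})) (𝒫-≥ 5≤k) (𝒫-≥¼-on-Thr 5≤k)
  where
  K : ℚ
  K = fromℤ (+ k)
  K⁴≡k^4/1 : K * (K * (K * (K * 1ℚ))) ≡ + (k ^ 4) / 1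
  K⁴≡k^4/1 = trans (sym (fromℤ-pos-^ k 4)) (fromℤ≡/1 (+ (k ^ 4)))
  1≤K : 1ℚ ≤ K
  1≤K = ≤-trans (≤ᵇ⇒≤ _) (fromℤ-mono-≤ (ℤ.+≤+ 5≤k))
  D : ℚ
  D = 4 * (K * K * K)
  ¼<D : 1/ 4 < D
  ¼<D = <-≤-trans (toWitness {a? = 1/ 4 <? 4} tt) (*-monoˡ-≤-nonNeg 4 (1≤* (1≤* 1≤K 1≤K) 1≤K))
  instance
    D-positive : Positive D
    D-positive = positive (<-trans (positive⁻¹ (1/ 4)) ¼<D)
    D-nonZero : NonZero D
    D-nonZero = pos⇒nonZero D
  r : ℚ
  r = 1/ D
  instance
    r-positive : Positive r
    r-positive = 1/pos⇒pos D

theorem5p10 : Σ ℚ λ c → (0ℚ < c) ×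
    (∀ (k : ℕ) → k % 2 ≡ 1 → 5 ℕ.≤ k →
      (Σ ℚ λ δ → Σ (MultilinPoly k) λ Q →
          (c ≤ δ * ((+ (k ^ 4)) / 1)) × DegreeAtMost 3 Q × Separates δ Q (Thr k -[1+ 0 ]))
      × ¬ SupportsTWise 3 (Thr k -[1+ 0 ]))
theorem5p10 = 1/ 16 , positive⁻¹ (1/ 16) , λ k _ 5≤k →
  let separable@(_ , _ , _ , degree , separation) = Thr-separable k 5≤k in
  separable , separates⇒¬supportsTWise (ℕₚ.≤-trans (ℕₚ.m≤n+m 3 2) 5≤k) degree separation
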